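{- Let $(G=(V,E),L,c,r,e_r)$ be a rooted WRAP instance and let $\vec F\subseteq V\times V$ be a non-shortenable directed WRAP solution of it. Then: (i) $(V,\vec F)$ is an arborescence rooted at $r$; (ii) $\vec F$ is $G$-planar; (iii) for every $v\in V$, no two directed links of $\delta^+_{\vec F}(v)$ go in the same direction, i.e., $\delta^+_{\vec F}(v)$ contains at most one left-going and at most one right-going link.
   Context: Rooted WRAP instance: a cycle $G=(V,E)$, links $L\subseteq\binom V2$, costs $c\colon L\to\mathbb R_{\ge0}$, root $r\in V$, edge $e_r\in E$ incident to $r$. $\mathcal C_G=\{C\subseteq V\setminus\{r\}:|\delta_E(C)|=2\}$. A directed link $(u,v)$ ($u\ne v$) covers $C\in\mathcal C_G$ if $v\in C$, $u\notin C$. A directed WRAP solution is $\vec F\subseteq V\times V$ such that each $C\in\mathcal C_G$ is entered by a link of $\vec F$. A shortening of $(u,v)$ is $(s,v)$ with $s\ne v$ on the $u$-$v$ path in the path $(V,E\setminus\{e_r\})$; strict if $s\ne u$. $\vec F$ is non-shortenable if deleting any link or replacing any link by a strict shortening destroys the directed-solution property. Two pairs $\{a,b\},\{x,y\}$ of vertices cross if they share no endpoint and each of the two paths of $G$ between $a$ and $b$ contains one of $x,y$; a set of (directed, orientation ignored) links is $G$-planar if no two of its members cross. Number $V=\{r=v_0,\dots,v_{n-1}\}$ along the path $(V,E\setminus\{e_r\})$ starting at $r$; $(v_i,v_j)$ is left-going if $i>j$ and right-going if $i<j$. $\delta^+_{\vec F}(v)$ is the set of links of $\vec F$ with tail $v$.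 -}

module Defs where

open import Data.Nat using (ℕ; zero; suc; _+_)
open import Data.Bool using (Bool; true; false; if_then_else_; _xor_; _∧_)
open import Data.Fin using (Fin; zero; suc; inject₁; fromℕ; _≤_; _<_; _≟_)
open import Data.List using (List; map; allFin)
open import Data.Nat.ListAction using (sum)
open import Data.Product using (Σ; ∃; _×_; _,_)
open import Data.Sum using (_⊎_)
open import Relation.Nullary using (¬_; does)
open import Relation.Binary.PropositionalEquality using (_≡_; _≢_)

-- Vertex set V = Fin (suc n) = {v₀,…,vₙ}, numbered along the path (V, E ∖ {e_r}),
-- root r = v₀ = zero.  Cycle edges: {vᵢ, vᵢ₊₁} for i < n, and e_r = {vₙ, v₀}.
-- A cycle needs at least 3 vertices, i.e. 2 ≤ n (assumed in the theorem).

root : ∀ {n} → Fin (suc n)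
root = zero

VSet : ℕ → Set
VSet N = Fin N → Bool

DSet : ℕ → Set
DSet N = Fin N → Fin N → Bool

_∈D_ : ∀ {N} → Fin N × Fin N → DSet N → Set
(u , v) ∈D F = F u v ≡ true

cutSize : ∀ {n} → VSet (suc n) → ℕ
cutSize {n} C =
  sum (map (λ i → if C (inject₁ i) xor C (suc i) then 1 else 0) (allFin n))
  + (if C (fromℕ n) xor C zero then 1 else 0)

InCG : ∀ {n} → VSet (suc n) → Set
InCG C = (C root ≡ false) × (cutSize C ≡ 2)

Covers : ∀ {N} → Fin N → Fin N → VSet N → Set
Covers u v C = (C v ≡ true) × (C u ≡ false)

LinksOnly : ∀ {N} → DSet N → Set
LinksOnly F = ∀ u v → (u , v) ∈D F → u ≢ v

DirSolution : ∀ {n} → DSet (suc n) → Set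
DirSolution F = ∀ C → InCG C → ∃ λ u → ∃ λ v → ((u , v) ∈D F) × Covers u v C

-- s lies on the u–v path of the path graph (V, E ∖ {e_r}) (endpoints included)
OnPath : ∀ {N} → Fin N → Fin N → Fin N → Set
OnPath u v s = ((u ≤ s) × (s ≤ v)) ⊎ ((v ≤ s) × (s ≤ u))

delete : ∀ {N} → DSet N → Fin N → Fin N → DSet N
delete F u v a b = if does (a ≟ u) ∧ does (b ≟ v) then false else F a b

replace : ∀ {N} → DSet N → Fin N → Fin N → Fin N → DSet N
replace F u v s a b = if does (a ≟ s) ∧ does (b ≟ v) then true else delete F u v a b

NonShortenable : ∀ {n} → DSet (suc n) → Set
NonShortenable F =
  DirSolution F
  × (∀ u v → (u , v) ∈D F → ¬ DirSolution (delete F u v))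
  × (∀ u v s → (u , v) ∈D F → OnPath u v s → s ≢ v → s ≢ u
       → ¬ DirSolution (replace F u v s))

data Reach {N} (F : DSet N) (r : Fin N) : Fin N → Set where
  here : Reach F r r
  step : ∀ {u v} → Reach F r u → (u , v) ∈D F → Reach F r v

Arborescence : ∀ {N} → DSet N → Fin N → Set
Arborescence {N} F r =
  (∀ u → ¬ ((u , r) ∈D F))
  × (∀ v → v ≢ r → ∃ λ u → ((u , v) ∈D F) × (∀ u' → (u' , v) ∈D F → u' ≡ u))
  × (∀ v → Reach F r v)

-- x lies on the other path of the cycle G between a and b (the one using e_r)
OnOtherPath : ∀ {N} → Fin N → Fin N → Fin N → Set
OnOtherPath a b x = (x ≡ a) ⊎ (x ≡ b) ⊎ ¬ OnPath a b x

Cross : ∀ {N} → Fin N → Fin N → Fin N → Fin N → Set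
Cross a b x y =
  (a ≢ x) × (a ≢ y) × (b ≢ x) × (b ≢ y)
  × ((OnPath a b x × OnOtherPath a b y) ⊎ (OnPath a b y × OnOtherPath a b x))

GPlanar : ∀ {N} → DSet N → Set
GPlanar F = ∀ a b x y → (a , b) ∈D F → (x , y) ∈D F → ¬ Cross a b x y

OutDirUnique : ∀ {N} → DSet N → Set
OutDirUnique F =
  (∀ v w w' → (v , w) ∈D F → (v , w') ∈D F → w < v → w' < v → w ≡ w')
  × (∀ v w w' → (v , w) ∈D F → (v , w') ∈D F → v < w → v < w' → w ≡ w')

-- Counting the changes of membership around the cycle, the sets in 𝒞_G are exactly the intervals
-- {vᵢ, …, vⱼ}, 1 ≤ i ≤ j ≤ n, of the path v₀ … vₙ, so a directed solution is a set of links entering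
-- every such interval. Shortening a link (u , v) of a non-shortenable solution F to (s , v), where s is
-- the neighbour of u towards v (deleting it if s = v), leaves some interval unentered: an interval
-- containing v and s but not u, which (u , v) is the only link of F to enter. For a second link lying in
-- this interval of (u , v) this is already a contradiction; otherwise the intervals of the two links
-- overlap and their union is an interval containing both tails, hence entered by neither link. This
-- rules out two links into one vertex, two out-links in one direction and crossing links. Finally every
-- vertex is reachable from r: an interval whose entering links have reachable tails is split at the head
-- of one of them, and planarity shows that the two halves inherit that property.
module Submission where

open import Data.Bool using (Bool; true; false; _xor_; _∧_; if_then_else_)
import Data.Bool as Bool
open import Data.Empty using (⊥; ⊥-elim)
open import Data.Fin using (Fin; zero; suc; toℕ; inject₁; fromℕ; fromℕ<; _≟_)
open import Data.Fin.Properties using (toℕ-injective; toℕ-fromℕ; toℕ≤pred[n]; toℕ-fromℕ<; toℕ-inject₁; any?)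
open import Data.List using (_∷_; map; allFin)
open import Data.List.Properties using (map-tabulate)
open import Data.Nat using (ℕ; zero; suc; pred; _+_; _≤_; _<_; z≤n; s≤s; z<s; _≤?_; s≤s⁻¹; >-nonZero)
open import Data.Nat.ListAction using (sum)
open import Data.Nat.Properties
  using (+-assoc; +-cancelʳ-≡; +-comm; +-identityʳ; +-monoʳ-<; +-monoʳ-≤; 0≢1+n; 1+n≢n; <-cmp; <-trans; <-≤-trans;
         <⇒≢; <⇒≤; <⇒≤pred; <⇒≱; m+n≡0⇒m≡0; m+n≡0⇒n≡0; m≤m+n; m≤n⇒m<n∨m≡n; m≤n⇒m≤1+n; n<1+n; n≤1+n; pred[n]≤n;
         suc-pred; ≤-<-trans; ≤-antisym; ≤-refl; ≤-total; ≤-trans; ≤∧≢⇒<; ≮⇒≥; ≰⇒>)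
open import Data.Product using (∃; ∃₂; _×_; _,_; proj₁; proj₂)
open import Data.Sum using (_⊎_; inj₁; inj₂; swap)
import Data.Sum as Sum
open import Function using (_∘_; id)
open import Relation.Binary.Definitions using (tri<; tri≈; tri>)
open import Relation.Binary.PropositionalEquality
  using (_≡_; _≢_; refl; sym; trans; cong; cong₂; subst; module ≡-Reasoning)
open import Relation.Nullary using (¬_; Dec; does; yes; no)
open import Relation.Nullary.Decidable using (dec-true; dec-false; _×-dec_; ¬?; decidable-stable)
open import Relation.Nullary.Negation using (¬¬-map)

open import Defs

-- Intervals and sequences of ℕ

_∈[_,_] : ℕ → ℕ → ℕ → Set
k ∈[ i , j ] = i ≤ k × k ≤ j

_∈[_,_]? : ∀ k i j → Dec (k ∈[ i , j ])
k ∈[ i , j ]? = (i ≤? k) ×-dec (k ≤? j)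

∉⇒<⊎> : ∀ {k i j} → ¬ k ∈[ i , j ] → k < i ⊎ j < k
∉⇒<⊎> {k} {i} {j} k∉ with i ≤? k | k ≤? j
... | no i≰k  | _       = inj₁ (≰⇒> i≰k)
... | yes _   | no k≰j  = inj₂ (≰⇒> k≰j)
... | yes i≤k | yes k≤j = ⊥-elim (k∉ (i≤k , k≤j))

-- Opaque, so that unification sees interval i j k instead of the unfolded decision procedure.
opaque
  interval : ℕ → ℕ → ℕ → Bool
  interval i j k = does (k ∈[ i , j ]?)

  interval-∈ : ∀ {i j k} → k ∈[ i , j ] → interval i j k ≡ true
  interval-∈ {i} {j} {k} = dec-true (k ∈[ i , j ]?)

  interval-∉ : ∀ {i j k} → ¬ k ∈[ i , j ] → interval i j k ≡ false
  interval-∉ {i} {j} {k} = dec-false (k ∈[ i , j ]?)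

  interval-≤ : ∀ i {j j' k} → k ≤ j → k ≤ j' → interval i j k ≡ interval i j' k
  interval-≤ i {j} {j'} {k} k≤j k≤j' =
    cong (does (i ≤? k) ∧_) (trans (dec-true (k ≤? j) k≤j) (sym (dec-true (k ≤? j') k≤j')))

  interval-true : ∀ {i j k} → interval i j k ≡ true → k ∈[ i , j ]
  interval-true {i} {j} {k} = witness (k ∈[ i , j ]?)
    where
    witness : ∀ {A : Set} (a? : Dec A) → does a? ≡ true → A
    witness (yes a) _ = a

  interval-false : ∀ {i j k} → interval i j k ≡ false → ¬ k ∈[ i , j ]
  interval-false {i} {j} {k} = refutation (k ∈[ i , j ]?)
    where
    refutation : ∀ {A : Set} (a? : Dec A) → does a? ≡ false → ¬ A
    refutation (no ¬a) _ = ¬a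

interval-below : ∀ {i j k} → k < i → interval i j k ≡ false
interval-below k<i = interval-∉ (λ (i≤k , _) → <⇒≱ k<i i≤k)

interval-above : ∀ {i j k} → j < k → interval i j k ≡ false
interval-above j<k = interval-∉ (λ (_ , k≤j) → <⇒≱ j<k k≤j)

differ : Bool → Bool → ℕ
differ a b = if a xor b then 1 else 0

differ-self : ∀ a → differ a a ≡ 0
differ-self false = refl
differ-self true  = refl

differ≡0⇒≡ : ∀ a b → differ a b ≡ 0 → a ≡ b
differ≡0⇒≡ false false _ = refl
differ≡0⇒≡ true  true  _ = refl

changes : (ℕ → Bool) → ℕ → ℕ
changes g zero    = 0
changes g (suc m) = changes g m + differ (g m) (g (suc m))

changes-suc : ∀ g m → changes g (suc m) ≡ differ (g 0) (g 1) + changes (g ∘ suc) m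
changes-suc g zero    = +-comm 0 (differ (g 0) (g 1))
changes-suc g (suc m) = trans (cong (_+ differ (g (suc m)) (g (suc (suc m)))) (changes-suc g m))
                              (+-assoc (differ (g 0) (g 1)) (changes (g ∘ suc) m) _)

changes-cong : ∀ {g h} m → (∀ k → g k ≡ h k) → changes g m ≡ changes h m
changes-cong zero    _ = refl
changes-cong (suc m) e = cong₂ _+_ (changes-cong m e) (cong₂ differ (e m) (e (suc m)))

cyclicChanges : (ℕ → Bool) → ℕ → ℕ
cyclicChanges g m = changes g m + differ (g m) (g 0)

agreeUpTo-suc : ∀ {g h : ℕ → Bool} {m} → (∀ k → k ≤ m → g k ≡ h k) → g (suc m) ≡ h (suc m) →
                ∀ k → k ≤ suc m → g k ≡ h k
agreeUpTo-suc below top k k≤1+m with m≤n⇒m<n∨m≡n k≤1+m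
... | inj₁ k<1+m = below k (s≤s⁻¹ k<1+m)
... | inj₂ refl  = top

changes≡0⇒constant : ∀ g m → changes g m ≡ 0 → ∀ k → k ≤ m → g k ≡ g 0
changes≡0⇒constant g zero    _ = λ { .zero z≤n → refl }
changes≡0⇒constant g (suc m) h = agreeUpTo-suc below (trans (sym unchanged) (below m ≤-refl))
  where
  below : ∀ k → k ≤ m → g k ≡ g 0
  below = changes≡0⇒constant g m (m+n≡0⇒m≡0 _ h)
  unchanged : g m ≡ g (suc m)
  unchanged = differ≡0⇒≡ _ _ (m+n≡0⇒n≡0 (changes g m) h)

constant⇒changes≡0 : ∀ g m → (∀ k → k ≤ m → g k ≡ g 0) → changes g m ≡ 0
constant⇒changes≡0 g zero    _ = refl
constant⇒changes≡0 g (suc m) c = begin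
  changes g m + differ (g m) (g (suc m))
    ≡⟨ cong₂ _+_ (constant⇒changes≡0 g m (λ k k≤m → c k (m≤n⇒m≤1+n k≤m)))
                 (cong₂ differ (c m (n≤1+n m)) (c (suc m) ≤-refl)) ⟩
  0 + differ (g 0) (g 0)
    ≡⟨ differ-self (g 0) ⟩
  0 ∎
  where open ≡-Reasoning

cyclicChanges-stay : ∀ g m → g (suc m) ≡ g m → cyclicChanges g (suc m) ≡ cyclicChanges g m
cyclicChanges-stay g m e = begin
  changes g m + differ (g m) (g (suc m)) + differ (g (suc m)) (g 0)
    ≡⟨ cong (λ b → changes g m + differ (g m) b + differ b (g 0)) e ⟩
  changes g m + differ (g m) (g m) + differ (g m) (g 0)
    ≡⟨ cong (λ d → changes g m + d + differ (g m) (g 0)) (differ-self (g m)) ⟩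
  changes g m + 0 + differ (g m) (g 0)
    ≡⟨ cong (_+ differ (g m) (g 0)) (+-identityʳ (changes g m)) ⟩
  cyclicChanges g m ∎
  where open ≡-Reasoning

cyclicChanges-return : ∀ g m → g (suc m) ≡ g 0 → cyclicChanges g (suc m) ≡ cyclicChanges g m
cyclicChanges-return g m e = begin
  changes g m + differ (g m) (g (suc m)) + differ (g (suc m)) (g 0)
    ≡⟨ cong (λ b → changes g m + differ (g m) b + differ b (g 0)) e ⟩
  changes g m + differ (g m) (g 0) + differ (g 0) (g 0)
    ≡⟨ cong (changes g m + differ (g m) (g 0) +_) (differ-self (g 0)) ⟩
  cyclicChanges g m + 0
    ≡⟨ +-identityʳ _ ⟩
  cyclicChanges g m ∎
  where open ≡-Reasoning

cyclicChanges-rise : ∀ g m → g 0 ≡ false → g m ≡ false → g (suc m) ≡ true →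
                     cyclicChanges g (suc m) ≡ changes g m + 2
cyclicChanges-rise g m g0 gm g1+m rewrite g0 | gm | g1+m = +-assoc (changes g m) 1 1

interval-cyclicChanges : ∀ {i j} → 1 ≤ i → i ≤ j → ∀ m → i ≤ m → cyclicChanges (interval i j) m ≡ 2
interval-cyclicChanges {suc i} {j} _ i≤j (suc m) 1+i≤1+m with m≤n⇒m<n∨m≡n 1+i≤1+m
... | inj₂ refl = begin
  cyclicChanges g (suc m) ≡⟨ cyclicChanges-rise g m (before z<s) (before ≤-refl) (interval-∈ (≤-refl , i≤j)) ⟩
  changes g m + 2         ≡⟨ cong (_+ 2) (constant⇒changes≡0 g m (λ k k≤m → trans (before (s≤s k≤m)) (sym (before z<s)))) ⟩
  2                       ∎
  where
  open ≡-Reasoning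
  g : ℕ → Bool
  g = interval (suc m) j
  before : ∀ {k} → k < suc m → g k ≡ false
  before = interval-below
... | inj₁ 1+i<1+m =
  trans (cyclicChanges-step (suc m ≤? j)) (interval-cyclicChanges {suc i} {j} z<s i≤j m (s≤s⁻¹ 1+i<1+m))
  where
  g : ℕ → Bool
  g = interval (suc i) j
  cyclicChanges-step : Dec (suc m ≤ j) → cyclicChanges g (suc m) ≡ cyclicChanges g m
  cyclicChanges-step (yes 1+m≤j) = cyclicChanges-stay g m
    (trans (interval-∈ (<⇒≤ 1+i<1+m , 1+m≤j)) (sym (interval-∈ (s≤s⁻¹ 1+i<1+m , ≤-trans (n≤1+n m) 1+m≤j))))
  cyclicChanges-step (no 1+m≰j) = cyclicChanges-return g m
    (trans (interval-above (≰⇒> 1+m≰j)) (sym (interval-below z<s)))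

cyclicChanges≡2⇒interval : ∀ g m → g 0 ≡ false → cyclicChanges g m ≡ 2 →
  ∃₂ λ i j → 1 ≤ i × i ≤ j × j ≤ m × (∀ k → k ≤ m → g k ≡ interval i j k)
cyclicChanges≡2⇒interval g zero _ c = ⊥-elim (0≢1+n (trans (sym (differ-self (g 0))) c))
cyclicChanges≡2⇒interval g (suc m) g0 c = byCases (g m) (g (suc m)) refl refl
  where
  Description : Set
  Description = ∃₂ λ i j → 1 ≤ i × i ≤ j × j ≤ suc m × (∀ k → k ≤ suc m → g k ≡ interval i j k)
  byCases : ∀ b b' → g m ≡ b → g (suc m) ≡ b' → Description
  byCases _ false _ g1+m
    with cyclicChanges≡2⇒interval g m g0 (trans (sym (cyclicChanges-return g m (trans g1+m (sym g0)))) c)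
  ... | i , j , 1≤i , i≤j , j≤m , below =
    i , j , 1≤i , i≤j , m≤n⇒m≤1+n j≤m , agreeUpTo-suc below (trans g1+m (sym (interval-above (s≤s j≤m))))
  byCases true true gm g1+m
    with cyclicChanges≡2⇒interval g m g0 (trans (sym (cyclicChanges-stay g m (trans g1+m (sym gm)))) c)
  ... | i , j , 1≤i , i≤j , j≤m , below with interval-true (trans (sym (below m ≤-refl)) gm)
  ... | i≤m , m≤j =
    i , suc m , 1≤i , m≤n⇒m≤1+n i≤m , ≤-refl ,
    agreeUpTo-suc (λ k k≤m → trans (below k k≤m) (interval-≤ i (≤-trans k≤m m≤j) (m≤n⇒m≤1+n k≤m)))
                  (trans g1+m (sym (interval-∈ (m≤n⇒m≤1+n i≤m , ≤-refl))))
  byCases false true gm g1+m =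
    suc m , suc m , z<s , ≤-refl , ≤-refl , agreeUpTo-suc below (trans g1+m (sym (interval-∈ (≤-refl , ≤-refl))))
    where
    noChanges : changes g m ≡ 0
    noChanges = +-cancelʳ-≡ 2 (changes g m) 0 (trans (sym (cyclicChanges-rise g m g0 gm g1+m)) c)
    below : ∀ k → k ≤ m → g k ≡ interval (suc m) (suc m) k
    below k k≤m = trans (changes≡0⇒constant g m noChanges k k≤m) (trans g0 (sym (interval-below (s≤s k≤m))))

-- The sets of 𝒞_G are the intervals

extend : ∀ {n} → VSet (suc n) → ℕ → Bool
extend C zero = C zero
extend {zero}  C (suc k) = false
extend {suc n} C (suc k) = extend (C ∘ suc) k

extend-toℕ : ∀ {n} (C : VSet (suc n)) x → extend C (toℕ x) ≡ C x
extend-toℕ C       zero    = refl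
extend-toℕ {suc n} C (suc x) = extend-toℕ (C ∘ suc) x

extend-unique : ∀ {n} (C : VSet (suc n)) (h : ℕ → Bool) → (∀ x → C x ≡ h (toℕ x)) →
                (∀ k → n < k → h k ≡ false) → ∀ k → extend C k ≡ h k
extend-unique C h onFin _ zero = onFin zero
extend-unique {zero}  C h _ beyond (suc k) = sym (beyond (suc k) z<s)
extend-unique {suc n} C h onFin beyond (suc k) =
  extend-unique (C ∘ suc) (h ∘ suc) (onFin ∘ suc) (λ k n<k → beyond (suc k) (s≤s n<k)) k

sum-allFin-suc : ∀ {n} (f : Fin (suc n) → ℕ) → sum (map f (allFin (suc n))) ≡ f zero + sum (map (f ∘ suc) (allFin n))
sum-allFin-suc f = cong (λ fs → sum (f zero ∷ fs)) (trans (map-tabulate suc f) (sym (map-tabulate id (f ∘ suc))))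

cutSize≡cyclicChanges : ∀ {n} (C : VSet (suc n)) → cutSize C ≡ cyclicChanges (extend C) n
cutSize≡cyclicChanges {n} C =
  cong₂ _+_ (pathChanges C)
            (cong (λ b → differ b (C zero)) (trans (sym (extend-toℕ C (fromℕ n))) (cong (extend C) (toℕ-fromℕ n))))
  where
  pathChanges : ∀ {n} (C : VSet (suc n)) →
                sum (map (λ i → differ (C (inject₁ i)) (C (suc i))) (allFin n)) ≡ changes (extend C) n
  pathChanges {zero}  C = refl
  pathChanges {suc n} C = begin
    sum (map (λ i → differ (C (inject₁ i)) (C (suc i))) (allFin (suc n)))
      ≡⟨ sum-allFin-suc (λ i → differ (C (inject₁ i)) (C (suc i))) ⟩
    differ (C zero) (C (suc zero)) + sum (map (λ i → differ (C (suc (inject₁ i))) (C (suc (suc i)))) (allFin n))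
      ≡⟨ cong (differ (C zero) (C (suc zero)) +_) (pathChanges (C ∘ suc)) ⟩
    differ (C zero) (C (suc zero)) + changes (extend (C ∘ suc)) n
      ≡⟨ sym (changes-suc (extend C) n) ⟩
    changes (extend C) (suc n)
      ∎
    where open ≡-Reasoning

intervalSet : ∀ {n} → ℕ → ℕ → VSet (suc n)
intervalSet i j x = interval i j (toℕ x)

NonRootInterval : ℕ → ℕ → ℕ → Set
NonRootInterval n i j = 1 ≤ i × i ≤ j × j ≤ n

intervalSet∈CG : ∀ {n i j} → NonRootInterval n i j → InCG (intervalSet {n} i j)
intervalSet∈CG {n} {i} {j} (1≤i , i≤j , j≤n) = interval-below 1≤i , (begin
  cutSize (intervalSet {n} i j)                ≡⟨ cutSize≡cyclicChanges (intervalSet i j) ⟩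
  cyclicChanges (extend (intervalSet {n} i j)) n ≡⟨ cong₂ _+_ (changes-cong n agree) (cong₂ differ (agree n) (agree 0)) ⟩
  cyclicChanges (interval i j) n               ≡⟨ interval-cyclicChanges 1≤i i≤j n (≤-trans i≤j j≤n) ⟩
  2                                            ∎)
  where
  open ≡-Reasoning
  agree : ∀ k → extend (intervalSet {n} i j) k ≡ interval i j k
  agree = extend-unique (intervalSet i j) (interval i j) (λ _ → refl) (λ k n<k → interval-above (≤-<-trans j≤n n<k))

CG⇒intervalSet : ∀ {n} (C : VSet (suc n)) → InCG C →
                 ∃₂ λ i j → NonRootInterval n i j × (∀ x → C x ≡ intervalSet i j x)
CG⇒intervalSet {n} C (C0 , cut)
  with cyclicChanges≡2⇒interval (extend C) n C0 (trans (sym (cutSize≡cyclicChanges C)) cut)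
... | i , j , 1≤i , i≤j , j≤n , agree =
  i , j , (1≤i , i≤j , j≤n) , λ x → trans (sym (extend-toℕ C x)) (agree (toℕ x) (toℕ≤pred[n] x))

-- Directed solutions and non-shortenability

Enters : ∀ {n} → DSet (suc n) → ℕ → ℕ → Set
Enters G i j = ∃₂ λ a b → (a , b) ∈D G × toℕ b ∈[ i , j ] × ¬ toℕ a ∈[ i , j ]

solution⇒enters : ∀ {n} {G : DSet (suc n)} {i j} → DirSolution G → NonRootInterval n i j → Enters G i j
solution⇒enters {G = G} {i} {j} solution ij with solution (intervalSet i j) (intervalSet∈CG ij)
... | a , b , ab∈G , b∈C , a∉C = a , b , ab∈G , interval-true b∈C , interval-false a∉C

enters⇒solution : ∀ {n} {G : DSet (suc n)} → (∀ {i j} → NonRootInterval n i j → Enters G i j) → DirSolution G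
enters⇒solution enters C C∈CG with CG⇒intervalSet C C∈CG
... | i , j , ij , C≡ with enters ij
...   | a , b , ab∈G , b∈ , a∉ = a , b , ab∈G , trans (C≡ b) (interval-∈ b∈) , trans (C≡ a) (interval-∉ a∉)

delete-keeps : ∀ {N} (F : DSet N) {u v a b} → (a , b) ∈D F → ¬ (a ≡ u × b ≡ v) → (a , b) ∈D delete F u v
delete-keeps F {u} {v} {a} {b} ab∈F ab≢uv =
  trans (cong (λ c → if c then false else F a b) (dec-false ((a ≟ u) ×-dec (b ≟ v)) ab≢uv)) ab∈F

replace-keeps : ∀ {N} (F : DSet N) {u v s a b} → (a , b) ∈D F → ¬ (a ≡ u × b ≡ v) → (a , b) ∈D replace F u v s
replace-keeps F {u} {v} {s} {a} {b} ab∈F ab≢uv with does (a ≟ s) ∧ does (b ≟ v)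
... | true  = refl
... | false = delete-keeps F ab∈F ab≢uv

replace-adds : ∀ {N} (F : DSet N) u v s → (s , v) ∈D replace F u v s
replace-adds F u v s rewrite dec-true (s ≟ s) refl | dec-true (v ≟ v) refl = refl

module NonShortenableSolution {n} (F : DSet (suc n)) (links : LinksOnly F) (nonShortenable : NonShortenable F) where

  private
    V : Set
    V = Fin (suc n)

  ⟦_⟧ : V → ℕ
  ⟦_⟧ = toℕ

  solution : DirSolution F
  solution = proj₁ nonShortenable

  UniquelyEntered : V → V → ℕ → ℕ → Set
  UniquelyEntered u v i j = ∀ {a b} → (a , b) ∈D F → ⟦ b ⟧ ∈[ i , j ] → ¬ ⟦ a ⟧ ∈[ i , j ] → a ≡ u × b ≡ v

  uniquelyEntered-or-other : ∀ u v i j → UniquelyEntered u v i j ⊎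
    ∃₂ λ a b → (a , b) ∈D F × ¬ (a ≡ u × b ≡ v) × ⟦ b ⟧ ∈[ i , j ] × ¬ ⟦ a ⟧ ∈[ i , j ]
  uniquelyEntered-or-other u v i j
    with any? (λ a → any? (λ b → (F a b Bool.≟ true) ×-dec ¬? ((a ≟ u) ×-dec (b ≟ v))
                                 ×-dec (⟦ b ⟧ ∈[ i , j ]?) ×-dec ¬? (⟦ a ⟧ ∈[ i , j ]?)))
  ... | yes other  = inj₂ other
  ... | no noOther = inj₁ λ {a} {b} ab∈F b∈ a∉ →
    decidable-stable ((a ≟ u) ×-dec (b ≟ v)) λ ab≢uv → noOther (a , b , ab∈F , ab≢uv , b∈ , a∉)

  -- An interval showing that (u , v) cannot be shortened to (s , v): only (u , v) enters it, and
  -- (s , v) would not.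
  Blocker : V → V → V → ℕ → ℕ → Set
  Blocker u v s i j =
    NonRootInterval n i j × ⟦ v ⟧ ∈[ i , j ] × ⟦ s ⟧ ∈[ i , j ] × ¬ ⟦ u ⟧ ∈[ i , j ] × UniquelyEntered u v i j

  solution-without-blocker : ∀ {u v s} (G : DSet (suc n)) →
    (∀ {a b} → (a , b) ∈D F → ¬ (a ≡ u × b ≡ v) → (a , b) ∈D G) →
    (∀ {i j} → NonRootInterval n i j → ⟦ v ⟧ ∈[ i , j ] → ¬ ⟦ s ⟧ ∈[ i , j ] → Enters G i j) →
    ¬ ∃₂ (Blocker u v s) → DirSolution G
  solution-without-blocker {u} {v} {s} G keeps entersWithout noBlocker = enters⇒solution entersG
    where
    entersG : ∀ {i j} → NonRootInterval n i j → Enters G i j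
    entersG {i} {j} ij with uniquelyEntered-or-other u v i j
    ... | inj₂ (a , b , ab∈F , ab≢uv , b∈ , a∉) = a , b , keeps ab∈F ab≢uv , b∈ , a∉
    ... | inj₁ unique with solution⇒enters solution ij
    ...   | a , b , ab∈F , b∈ , a∉ with unique ab∈F b∈ a∉
    ...     | refl , refl with ⟦ s ⟧ ∈[ i , j ]?
    ...       | yes s∈ = ⊥-elim (noBlocker (i , j , ij , b∈ , s∈ , a∉ , unique))
    ...       | no s∉  = entersWithout ij b∈ s∉

  -- Only double-negated, since it is read off the failure of the shortened set to be a solution; every
  -- use concludes ⊥ or a decidable equality of vertices.
  shortening-blocked : ∀ {u v s} → (u , v) ∈D F → OnPath u v s → s ≢ u → ¬ ¬ ∃₂ (Blocker u v s)
  shortening-blocked {u} {v} {s} uv∈F onPath s≢u noBlocker with s ≟ v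
  ... | yes refl = proj₁ (proj₂ nonShortenable) u v uv∈F
                     (solution-without-blocker (delete F u v) (delete-keeps F) (λ _ v∈ v∉ → ⊥-elim (v∉ v∈)) noBlocker)
  ... | no s≢v   = proj₂ (proj₂ nonShortenable) u v s uv∈F onPath s≢v s≢u
                     (solution-without-blocker (replace F u v s) (replace-keeps F)
                        (λ _ v∈ s∉ → s , v , replace-adds F u v s , v∈ , s∉) noBlocker)

  RightBlocker : V → V → Set
  RightBlocker u v = ∃ λ j → ⟦ v ⟧ ≤ j × j ≤ n × UniquelyEntered u v (suc ⟦ u ⟧) j

  LeftBlocker : V → V → Set
  LeftBlocker u v = ∃₂ λ i j → 1 ≤ i × i ≤ ⟦ v ⟧ × suc j ≡ ⟦ u ⟧ × UniquelyEntered u v i j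

  right-blocker : ∀ {u v} → (u , v) ∈D F → ⟦ u ⟧ < ⟦ v ⟧ → ¬ ¬ RightBlocker u v
  right-blocker {u} {v} uv∈F u<v = ¬¬-map fromBlocker (shortening-blocked uv∈F onPath next≢u)
    where
    1+u<1+n : suc ⟦ u ⟧ < suc n
    1+u<1+n = s≤s (≤-trans u<v (toℕ≤pred[n] v))
    next : V
    next = fromℕ< 1+u<1+n
    ⟦next⟧≡ : ⟦ next ⟧ ≡ suc ⟦ u ⟧
    ⟦next⟧≡ = toℕ-fromℕ< 1+u<1+n
    onPath : OnPath u v next
    onPath = inj₁ (subst (⟦ u ⟧ ≤_) (sym ⟦next⟧≡) (n≤1+n _) , subst (_≤ ⟦ v ⟧) (sym ⟦next⟧≡) u<v)
    next≢u : next ≢ u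
    next≢u next≡u = 1+n≢n (trans (sym ⟦next⟧≡) (cong toℕ next≡u))
    fromBlocker : ∃₂ (Blocker u v next) → RightBlocker u v
    fromBlocker (i , j , (_ , _ , j≤n) , (_ , v≤j) , (i≤next , _) , u∉ , unique) =
      j , v≤j , j≤n , subst (λ i → UniquelyEntered u v i j) i≡1+u unique
      where
      i≡1+u : i ≡ suc ⟦ u ⟧
      i≡1+u = ≤-antisym (subst (i ≤_) ⟦next⟧≡ i≤next) (≰⇒> λ i≤u → u∉ (i≤u , ≤-trans (<⇒≤ u<v) v≤j))

  left-blocker : ∀ {u v} → (u , v) ∈D F → ⟦ v ⟧ < ⟦ u ⟧ → ¬ ¬ LeftBlocker u v
  left-blocker {suc u'} {v} uv∈F v<u = ¬¬-map fromBlocker (shortening-blocked uv∈F onPath prev≢u)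
    where
    prev : V
    prev = inject₁ u'
    onPath : OnPath (suc u') v prev
    onPath = inj₂ (subst (⟦ v ⟧ ≤_) (sym (toℕ-inject₁ u')) (s≤s⁻¹ v<u) ,
                   subst (_≤ suc (toℕ u')) (sym (toℕ-inject₁ u')) (n≤1+n _))
    prev≢u : prev ≢ suc u'
    prev≢u prev≡u = 1+n≢n (sym (trans (sym (toℕ-inject₁ u')) (cong toℕ prev≡u)))
    fromBlocker : ∃₂ (Blocker (suc u') v prev) → LeftBlocker (suc u') v
    fromBlocker (i , j , (1≤i , _ , _) , (i≤v , _) , (_ , prev≤j) , u∉ , unique) =
      i , j , 1≤i , i≤v , cong suc j≡u' , unique
      where
      j≡u' : j ≡ toℕ u'
      j≡u' = ≤-antisym (s≤s⁻¹ (≰⇒> λ u≤j → u∉ (≤-trans i≤v (<⇒≤ v<u) , u≤j))) (subst (_≤ j) (toℕ-inject₁ u') prev≤j)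

  right-nested : ∀ {u v a b} → (u , v) ∈D F → ⟦ u ⟧ < ⟦ v ⟧ → (a , b) ∈D F →
                ⟦ a ⟧ ≤ ⟦ u ⟧ → ⟦ u ⟧ < ⟦ b ⟧ → ⟦ b ⟧ ≤ ⟦ v ⟧ → a ≡ u × b ≡ v
  right-nested {u} {v} {a} {b} uv∈F u<v ab∈F a≤u u<b b≤v =
    decidable-stable ((a ≟ u) ×-dec (b ≟ v)) λ ab≢uv →
      right-blocker uv∈F u<v λ (j , v≤j , _ , unique) →
        ab≢uv (unique ab∈F (u<b , ≤-trans b≤v v≤j) (λ (u<a , _) → <⇒≱ u<a a≤u))

  left-nested : ∀ {u v a b} → (u , v) ∈D F → ⟦ v ⟧ < ⟦ u ⟧ → (a , b) ∈D F →
               ⟦ u ⟧ ≤ ⟦ a ⟧ → ⟦ v ⟧ ≤ ⟦ b ⟧ → ⟦ b ⟧ < ⟦ u ⟧ → a ≡ u × b ≡ v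
  left-nested {u} {v} {a} {b} uv∈F v<u ab∈F u≤a v≤b b<u =
    decidable-stable ((a ≟ u) ×-dec (b ≟ v)) λ ab≢uv →
      left-blocker uv∈F v<u λ (i , j , _ , i≤v , 1+j≡u , unique) →
        ab≢uv (unique ab∈F (≤-trans i≤v v≤b , s≤s⁻¹ (subst (⟦ b ⟧ <_) (sym 1+j≡u) b<u))
                           (λ (_ , a≤j) → <⇒≱ (subst (_≤ ⟦ a ⟧) (sym 1+j≡u) u≤a) a≤j))

  uniquelyEntered-union-tail∉ : ∀ {u₁ v₁ u₂ v₂ i₁ j₁ i₂ j₂} →
    UniquelyEntered u₁ v₁ i₁ j₁ → UniquelyEntered u₂ v₂ i₂ j₂ →
    1 ≤ i₂ → i₂ ≤ i₁ → i₁ ≤ suc j₂ → j₂ ≤ j₁ → j₁ ≤ n →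
    ⟦ u₁ ⟧ ∈[ i₂ , j₁ ] → ¬ ⟦ u₂ ⟧ ∈[ i₂ , j₁ ]
  uniquelyEntered-union-tail∉ {j₁ = j₁} {i₂ = i₂} {j₂ = j₂} unique₁ unique₂ 1≤i₂ i₂≤i₁ i₁≤1+j₂ j₂≤j₁ j₁≤n u₁∈ u₂∈
    with solution⇒enters solution (1≤i₂ , ≤-trans (proj₁ u₁∈) (proj₂ u₁∈) , j₁≤n)
  ... | a , b , ab∈F , (i₂≤b , b≤j₁) , a∉ = a∉ (tail∈ (⟦ b ⟧ ≤? j₂))
    where
    tail∈ : Dec (⟦ b ⟧ ≤ j₂) → ⟦ a ⟧ ∈[ i₂ , j₁ ]
    tail∈ (yes b≤j₂)
      with unique₂ ab∈F (i₂≤b , b≤j₂) (λ (i₂≤a , a≤j₂) → a∉ (i₂≤a , ≤-trans a≤j₂ j₂≤j₁))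
    ... | refl , refl = u₂∈
    tail∈ (no b≰j₂)
      with unique₁ ab∈F (≤-trans i₁≤1+j₂ (≰⇒> b≰j₂) , b≤j₁) (λ (i₁≤a , a≤j₁) → a∉ (≤-trans i₂≤i₁ i₁≤a , a≤j₁))
    ... | refl , refl = u₁∈

  no-facing-pair : ∀ {u₁ v₁ u₂ v₂} → (u₁ , v₁) ∈D F → (u₂ , v₂) ∈D F →
                 ⟦ u₁ ⟧ < ⟦ v₂ ⟧ → ⟦ v₂ ⟧ ≤ ⟦ v₁ ⟧ → ⟦ v₁ ⟧ < ⟦ u₂ ⟧ → ⊥
  no-facing-pair {u₁} {v₁} {u₂} {v₂} e₁ e₂ u₁<v₂ v₂≤v₁ v₁<u₂ =
    right-blocker e₁ (<-≤-trans u₁<v₂ v₂≤v₁) λ right →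
    left-blocker e₂ (≤-<-trans v₂≤v₁ v₁<u₂) λ left → clash right left
    where
    u₁<u₂ : ⟦ u₁ ⟧ < ⟦ u₂ ⟧
    u₁<u₂ = <-trans u₁<v₂ (≤-<-trans v₂≤v₁ v₁<u₂)
    clash : RightBlocker u₁ v₁ → LeftBlocker u₂ v₂ → ⊥
    clash (j , v₁≤j , j≤n , unique₁) (i , j' , 1≤i , i≤v₂ , 1+j'≡u₂ , unique₂) with ⟦ u₂ ⟧ ≤? j | i ≤? ⟦ u₁ ⟧
    ... | no u₂≰j | _ = <⇒≢ u₁<u₂ (cong toℕ (sym (proj₁
          (unique₁ e₂ (u₁<v₂ , ≤-trans v₂≤v₁ v₁≤j) (λ (_ , u₂≤j) → u₂≰j u₂≤j)))))
    ... | yes _ | no i≰u₁ = <⇒≢ u₁<u₂ (cong toℕ (proj₁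
          (unique₂ e₁ (≤-trans i≤v₂ v₂≤v₁ , s≤s⁻¹ (subst (⟦ v₁ ⟧ <_) (sym 1+j'≡u₂) v₁<u₂)) (λ (i≤u₁ , _) → i≰u₁ i≤u₁))))
    ... | yes u₂≤j | yes i≤u₁ =
      uniquelyEntered-union-tail∉ unique₁ unique₂ 1≤i (≤-trans i≤u₁ (n≤1+n _))
        (subst (suc ⟦ u₁ ⟧ ≤_) (sym 1+j'≡u₂) u₁<u₂) (≤-trans (n≤1+n j') (subst (_≤ j) (sym 1+j'≡u₂) u₂≤j)) j≤n
        (i≤u₁ , ≤-trans (<⇒≤ u₁<u₂) u₂≤j) (≤-trans i≤u₁ (<⇒≤ u₁<u₂) , u₂≤j)

  no-back-to-back-pair : ∀ {u₁ v₁ u₂ v₂} → (u₁ , v₁) ∈D F → (u₂ , v₂) ∈D F →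
                     ⟦ v₂ ⟧ < ⟦ u₁ ⟧ → ⟦ u₁ ⟧ < ⟦ u₂ ⟧ → ⟦ u₂ ⟧ < ⟦ v₁ ⟧ → ⊥
  no-back-to-back-pair {u₁} {v₁} {u₂} {v₂} e₁ e₂ v₂<u₁ u₁<u₂ u₂<v₁ =
    right-blocker e₁ (<-trans u₁<u₂ u₂<v₁) λ (j , v₁≤j , j≤n , unique₁) →
    left-blocker e₂ (<-trans v₂<u₁ u₁<u₂) λ (i , j' , 1≤i , i≤v₂ , 1+j'≡u₂ , unique₂) →
      uniquelyEntered-union-tail∉ unique₁ unique₂ 1≤i (≤-trans i≤v₂ (≤-trans (<⇒≤ v₂<u₁) (n≤1+n _)))
        (subst (suc ⟦ u₁ ⟧ ≤_) (sym 1+j'≡u₂) u₁<u₂)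
        (≤-trans (n≤1+n j') (subst (_≤ j) (sym 1+j'≡u₂) (≤-trans (<⇒≤ u₂<v₁) v₁≤j))) j≤n
        (≤-trans i≤v₂ (<⇒≤ v₂<u₁) , ≤-trans (<⇒≤ (<-trans u₁<u₂ u₂<v₁)) v₁≤j)
        (≤-trans i≤v₂ (<⇒≤ (<-trans v₂<u₁ u₁<u₂)) , ≤-trans (<⇒≤ u₂<v₁) v₁≤j)

  right-or-left : ∀ {u v} → (u , v) ∈D F → ⟦ u ⟧ < ⟦ v ⟧ ⊎ ⟦ v ⟧ < ⟦ u ⟧
  right-or-left {u} {v} uv∈F with <-cmp ⟦ u ⟧ ⟦ v ⟧
  ... | tri< u<v _ _ = inj₁ u<v
  ... | tri≈ _ u≡v _ = ⊥-elim (links u v uv∈F (toℕ-injective u≡v))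
  ... | tri> _ _ v<u = inj₂ v<u

  inDegree≤1 : ∀ {u u' v} → (u , v) ∈D F → (u' , v) ∈D F → u' ≡ u
  inDegree≤1 {u} {u'} e e' with right-or-left e | right-or-left e' | ≤-total ⟦ u ⟧ ⟦ u' ⟧
  ... | inj₁ u<v | inj₁ u'<v | inj₁ u≤u' = sym (proj₁ (right-nested e' u'<v e u≤u' u'<v ≤-refl))
  ... | inj₁ u<v | inj₁ u'<v | inj₂ u'≤u = proj₁ (right-nested e u<v e' u'≤u u<v ≤-refl)
  ... | inj₂ v<u | inj₂ v<u' | inj₁ u≤u' = proj₁ (left-nested e v<u e' u≤u' ≤-refl v<u)
  ... | inj₂ v<u | inj₂ v<u' | inj₂ u'≤u = sym (proj₁ (left-nested e' v<u' e u'≤u ≤-refl v<u'))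
  ... | inj₁ u<v | inj₂ v<u' | _ = ⊥-elim (no-facing-pair e e' u<v ≤-refl v<u')
  ... | inj₂ v<u | inj₁ u'<v | _ = ⊥-elim (no-facing-pair e' e u'<v ≤-refl v<u)

  outDirUnique : OutDirUnique F
  outDirUnique = leftUnique , rightUnique
    where
    leftUnique : ∀ v w w' → (v , w) ∈D F → (v , w') ∈D F → ⟦ w ⟧ < ⟦ v ⟧ → ⟦ w' ⟧ < ⟦ v ⟧ → w ≡ w'
    leftUnique v w w' e e' w<v w'<v with ≤-total ⟦ w ⟧ ⟦ w' ⟧
    ... | inj₁ w≤w' = sym (proj₂ (left-nested e w<v e' ≤-refl w≤w' w'<v))
    ... | inj₂ w'≤w = proj₂ (left-nested e' w'<v e ≤-refl w'≤w w<v)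
    rightUnique : ∀ v w w' → (v , w) ∈D F → (v , w') ∈D F → ⟦ v ⟧ < ⟦ w ⟧ → ⟦ v ⟧ < ⟦ w' ⟧ → w ≡ w'
    rightUnique v w w' e e' v<w v<w' with ≤-total ⟦ w ⟧ ⟦ w' ⟧
    ... | inj₁ w≤w' = proj₂ (right-nested e' v<w' e ≤-refl v<w w≤w')
    ... | inj₂ w'≤w = sym (proj₂ (right-nested e v<w e' ≤-refl v<w' w'≤w))

  Linked : V → V → Set
  Linked a b = (a , b) ∈D F ⊎ (b , a) ∈D F

  no-crossing-ordered : ∀ {A B C D} → ⟦ A ⟧ < ⟦ B ⟧ → ⟦ B ⟧ < ⟦ C ⟧ → ⟦ C ⟧ < ⟦ D ⟧ → Linked A C → Linked B D → ⊥
  no-crossing-ordered A<B B<C C<D (inj₁ AC) (inj₁ BD) =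
    <⇒≢ A<B (cong toℕ (proj₁ (right-nested BD (<-trans B<C C<D) AC (<⇒≤ A<B) B<C (<⇒≤ C<D))))
  no-crossing-ordered A<B B<C C<D (inj₁ AC) (inj₂ DB) = no-facing-pair AC DB A<B (<⇒≤ B<C) C<D
  no-crossing-ordered A<B B<C C<D (inj₂ CA) (inj₁ BD) = no-back-to-back-pair BD CA A<B B<C C<D
  no-crossing-ordered A<B B<C C<D (inj₂ CA) (inj₂ DB) =
    <⇒≢ C<D (cong toℕ (sym (proj₁ (left-nested CA (<-trans A<B B<C) DB (<⇒≤ C<D) (<⇒≤ A<B) B<C))))

  no-crossing : ∀ {A B X Y} → Linked A B → Linked X Y → ⟦ A ⟧ < ⟦ X ⟧ → ⟦ X ⟧ < ⟦ B ⟧ →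
               ⟦ Y ⟧ < ⟦ A ⟧ ⊎ ⟦ B ⟧ < ⟦ Y ⟧ → ⊥
  no-crossing AB XY A<X X<B (inj₂ B<Y) = no-crossing-ordered A<X X<B B<Y AB XY
  no-crossing AB XY A<X X<B (inj₁ Y<A) = no-crossing-ordered Y<A A<X X<B (swap XY) AB

  separated : ∀ {a b x y} → Linked a b → Linked x y → a ≢ x → b ≢ x → a ≢ y → b ≢ y →
              OnPath a b x → OnOtherPath a b y → ⊥
  separated _ _ _ _ a≢y _ _ (inj₁ y≡a)        = a≢y (sym y≡a)
  separated _ _ _ _ _ b≢y _ (inj₂ (inj₁ y≡b)) = b≢y (sym y≡b)
  separated ab xy a≢x b≢x _ _ (inj₁ (a≤x , x≤b)) (inj₂ (inj₂ y∉)) =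
    no-crossing ab xy (≤∧≢⇒< a≤x (a≢x ∘ toℕ-injective)) (≤∧≢⇒< x≤b (b≢x ∘ sym ∘ toℕ-injective))
      (∉⇒<⊎> (y∉ ∘ inj₁))
  separated ab xy a≢x b≢x _ _ (inj₂ (b≤x , x≤a)) (inj₂ (inj₂ y∉)) =
    no-crossing (swap ab) xy (≤∧≢⇒< b≤x (b≢x ∘ toℕ-injective)) (≤∧≢⇒< x≤a (a≢x ∘ sym ∘ toℕ-injective))
      (∉⇒<⊎> (y∉ ∘ inj₂))

  planar : GPlanar F
  planar a b x y ab∈F xy∈F (a≢x , a≢y , b≢x , b≢y , inj₁ (x∈ , y∉)) =
    separated (inj₁ ab∈F) (inj₁ xy∈F) a≢x b≢x a≢y b≢y x∈ y∉
  planar a b x y ab∈F xy∈F (a≢x , a≢y , b≢x , b≢y , inj₂ (y∈ , x∉)) =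
    separated (inj₁ ab∈F) (inj₂ xy∈F) a≢y b≢y a≢x b≢x y∈ x∉

  Reachable : V → Set
  Reachable = Reach F root

  EntriesReachable : ℕ → ℕ → Set
  EntriesReachable i j = ∀ {a b} → (a , b) ∈D F → ⟦ b ⟧ ∈[ i , j ] → ¬ ⟦ a ⟧ ∈[ i , j ] → Reachable a

  entriesReachable-below : ∀ {a b i j j'} → (a , b) ∈D F → ⟦ b ⟧ ∈[ i , j ] → ¬ ⟦ a ⟧ ∈[ i , j ] →
    EntriesReachable i j → suc j' ≡ ⟦ b ⟧ → EntriesReachable i j'
  entriesReachable-below {a} {b} {i} {j} {j'} ab∈F b∈ a∉ entries 1+j'≡b {a'} {b'} a'b'∈F (i≤b' , b'≤j') a'∉
    with ⟦ a' ⟧ ∈[ i , j ]?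
  ... | no a'∉ij =
    entries a'b'∈F (i≤b' , ≤-trans b'≤j' (≤-trans (n≤1+n j') (subst (_≤ j) (sym 1+j'≡b) (proj₂ b∈)))) a'∉ij
  ... | yes (i≤a' , a'≤j) with m≤n⇒m<n∨m≡n (subst (_≤ ⟦ a' ⟧) 1+j'≡b (≰⇒> λ a'≤j' → a'∉ (i≤a' , a'≤j')))
  ...   | inj₂ b≡a' = subst Reachable (toℕ-injective b≡a') (step (entries ab∈F b∈ a∉) ab∈F)
  ...   | inj₁ b<a' = ⊥-elim (no-crossing (inj₂ a'b'∈F) (inj₂ ab∈F)
                        (subst (⟦ b' ⟧ <_) 1+j'≡b (s≤s b'≤j')) b<a'
                        (Sum.map (λ a<i → <-≤-trans a<i i≤b') (≤-<-trans a'≤j) (∉⇒<⊎> a∉)))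

  entriesReachable-above : ∀ {a b i j} → (a , b) ∈D F → ⟦ b ⟧ ∈[ i , j ] → ¬ ⟦ a ⟧ ∈[ i , j ] →
    EntriesReachable i j → EntriesReachable (suc ⟦ b ⟧) j
  entriesReachable-above {a} {b} {i} {j} ab∈F b∈ a∉ entries {a'} {b'} a'b'∈F (b<b' , b'≤j) a'∉
    with ⟦ a' ⟧ ∈[ i , j ]?
  ... | no a'∉ij = entries a'b'∈F (≤-trans (proj₁ b∈) (<⇒≤ b<b') , b'≤j) a'∉ij
  ... | yes (i≤a' , a'≤j) with m≤n⇒m<n∨m≡n (≮⇒≥ λ b<a' → a'∉ (b<a' , a'≤j))
  ...   | inj₂ a'≡b = subst Reachable (toℕ-injective (sym a'≡b)) (step (entries ab∈F b∈ a∉) ab∈F)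
  ...   | inj₁ a'<b = ⊥-elim (no-crossing (inj₁ a'b'∈F) (inj₂ ab∈F) a'<b b<b'
                        (Sum.map (λ a<i → <-≤-trans a<i i≤a') (≤-<-trans b'≤j) (∉⇒<⊎> a∉)))

  reachable-interval : ∀ k {i j} → j < k + i → 1 ≤ i → j ≤ n → EntriesReachable i j →
                       ∀ {x} → ⟦ x ⟧ ∈[ i , j ] → Reachable x
  reachable-interval zero j<i _ _ _ (i≤x , x≤j) = ⊥-elim (<⇒≱ j<i (≤-trans i≤x x≤j))
  reachable-interval (suc k) {i} {j} j<1+k+i 1≤i j≤n entries {x} (i≤x , x≤j)
    with solution⇒enters solution (1≤i , ≤-trans i≤x x≤j , j≤n)
  ... | a , b , ab∈F , b∈@(i≤b , b≤j) , a∉ with <-cmp ⟦ x ⟧ ⟦ b ⟧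
  ...   | tri≈ _ x≡b _ = subst Reachable (toℕ-injective (sym x≡b)) (step (entries ab∈F b∈ a∉) ab∈F)
  ...   | tri< x<b _ _ =
    reachable-interval k (subst (_≤ k + i) (sym 1+pred≡b) (≤-trans b≤j (s≤s⁻¹ j<1+k+i))) 1≤i
      (≤-trans pred[n]≤n (toℕ≤pred[n] b)) (entriesReachable-below ab∈F b∈ a∉ entries 1+pred≡b) (i≤x , <⇒≤pred x<b)
    where
    1+pred≡b : suc (pred ⟦ b ⟧) ≡ ⟦ b ⟧
    1+pred≡b = suc-pred ⟦ b ⟧ {{>-nonZero (≤-trans 1≤i i≤b)}}
  ...   | tri> _ _ b<x =
    reachable-interval k (≤-<-trans (≤-trans (s≤s⁻¹ j<1+k+i) (+-monoʳ-≤ k i≤b)) (+-monoʳ-< k (n<1+n ⟦ b ⟧)))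
      z<s j≤n
      (entriesReachable-above ab∈F b∈ a∉ entries) (b<x , x≤j)

  reachable : ∀ v → Reachable v
  reachable zero = here
  reachable v@(suc _) = reachable-interval (suc n) (s≤s (m≤m+n n 1)) z<s ≤-refl entries (z<s , toℕ≤pred[n] v)
    where
    entries : EntriesReachable 1 n
    entries {zero}  _ _ _  = here
    entries {a@(suc _)} _ _ a∉ = ⊥-elim (a∉ (z<s , toℕ≤pred[n] a))

  root-no-entry : ∀ u → ¬ (u , root) ∈D F
  root-no-entry u ur∈F with right-or-left ur∈F
  ... | inj₂ 0<u = left-blocker ur∈F 0<u λ (i , _ , 1≤i , i≤0 , _) → <⇒≱ 1≤i i≤0

  unique-parent : ∀ v → v ≢ root → ∃ λ u → (u , v) ∈D F × (∀ u' → (u' , v) ∈D F → u' ≡ u)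
  unique-parent zero v≢r = ⊥-elim (v≢r refl)
  unique-parent v@(suc _) _ with solution⇒enters solution (z<s , ≤-refl , toℕ≤pred[n] v)
  ... | u , b , ub∈F , (v≤b , b≤v) , _ with toℕ-injective (≤-antisym b≤v v≤b)
  ...   | refl = u , ub∈F , λ u' u'v∈F → inDegree≤1 ub∈F u'v∈F

-- The argument does not need the cycle to have at least three vertices.
theorem7 : (n : ℕ) → 2 ≤ n → (F : DSet (suc n)) → LinksOnly F → NonShortenable F
    → Arborescence F root × GPlanar F × OutDirUnique F
theorem7 n _ F links nonShortenable = (root-no-entry , unique-parent , reachable) , planar , outDirUnique
  where open NonShortenableSolution F links nonShortenable
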